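{- Let \(n>2\) be an integer. The number of subsets \(A\) of the real interval \((n/2,n]\) (i.e. of the integers \(a\) with \(n/2<a\le n\)) such that \(n\in A\) and \(\gcd(A)=1\) equals \[\sum_{d\mid n} \mu\!\left(\frac{n}{d}\right)\left(2^{\lfloor\frac{d-1}{2} \rfloor} -1\right),\] where the sum runs over the positive divisors \(d\) of \(n\).
   Context: \(\mu\) denotes the Möbius function. -}

module Defs where

open import Data.Nat using (ℕ; zero; suc; _+_; _*_; _<?_; _^_; _∸_; _/_)
open import Data.Nat.Divisibility using (_∣_; _∣?_)
open import Data.Nat.Primality using (Prime; prime?)
open import Data.Nat.GCD using (gcd)
open import Data.Integer as ℤ using (ℤ; +_)
open import Data.List using (List; []; _∷_; filter; upTo; length; map; _++_; foldr)
open import Data.List.Relation.Unary.Any using (any?)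
open import Data.Bool using (if_then_else_)
open import Data.Nat using (_≟_)
open import Relation.Nullary using (does)
open import Relation.Nullary.Decidable using (_×-dec_)

range1 : ℕ → List ℕ
range1 m = map suc (upTo m)

divisors : ℕ → List ℕ
divisors n = filter (λ d → d ∣? n) (range1 n)

ω : ℕ → ℕ
ω m = length (filter (λ p → prime? p ×-dec (p ∣? m)) (range1 m))

μ : ℕ → ℤ
μ m = if does (any? (λ p → prime? p ×-dec ((p * p) ∣? m)) (range1 m))
      then + 0
      else (ℤ.- (+ 1)) ℤ.^ ω m

sumℤ : List ℤ → ℤ
sumℤ = foldr ℤ._+_ (+ 0)

powerset : {A : Set} → List A → List (List A)
powerset [] = [] ∷ []
powerset (x ∷ xs) = let ps = powerset xs in ps ++ map (x ∷_) ps

-- gcd of a finite set of naturals (gcd of the empty set is 0)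
gcdList : List ℕ → ℕ
gcdList = foldr gcd 0

halfInterval : ℕ → List ℕ
halfInterval n = filter (λ a → n <? 2 * a) (range1 n)

open import Data.List.Membership.DecPropositional _≟_ using (_∈?_)

goodSubsets : ℕ → List (List ℕ)
goodSubsets n =
  filter (λ A → (n ∈? A) ×-dec (gcdList A ≟ 1)) (powerset (halfInterval n))

rhs : ℕ → ℤ
rhs n = sumℤ (map term (divisors n))
  where
  term : ℕ → ℤ
  term zero = + 0   -- never used: divisors are positive
  term d@(suc _) = μ (n / d) ℤ.* ((+ (2 ^ ((d ∸ 1) / 2))) ℤ.- (+ 1))

{-# OPTIONS --safe #-}

-- For A ⊆ (n/2, n] with n ∈ A, gcd A divides n, so Möbius inversion gives
-- [gcd A = 1] = Σ_{d ∣ n, d ∣ gcd A} μ(d).  Summing over A and exchanging the sums turns the count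
-- into Σ_{d ∣ n} μ(d) N(d), where N(d) counts the subsets A ∋ n consisting of multiples of d.
-- Those multiples form d·(m/2, m] with m = n/d, a set of ⌈m/2⌉ elements containing n, so
-- N(d) = 2^(⌈m/2⌉ - 1) = 2^⌊(m - 1)/2⌋.  Reindexing by d ↦ n/d and using Σ_{d ∣ n} μ(n/d) = 0
-- for n > 1 supplies the subtracted 1 in each term of the formula.
module Submission where

open import Defs
open import Data.Nat using (ℕ; _<_)
open import Data.List using (length)
open import Data.Integer using (+_)
open import Relation.Binary.PropositionalEquality using (_≡_)

open import Level using (Level)
open import Data.Bool using (true; false; if_then_else_)
open import Data.Integer as ℤ using (ℤ; 0ℤ; 1ℤ; -1ℤ; -_)
  renaming (_+_ to _+ℤ_; _*_ to _*ℤ_; _^_ to _^ℤ_)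
import Data.Integer.Properties as ℤ
open import Algebra.Properties.CommutativeSemigroup ℤ.+-commutativeSemigroup
  using (interchange; x∙yz≈y∙xz)
open import Data.List using (List; []; _∷_; _++_; map; filter; upTo)
import Data.List.Properties as List
open import Data.List.Membership.Propositional using (_∈_; find; lose)
open import Data.List.Membership.Propositional.Properties
  using (∈-filter⁺; ∈-filter⁻; ∈-map⁺; ∈-map⁻; ∈-upTo⁺; ∈-upTo⁻)
open import Data.List.Membership.Propositional.Properties.WithK using (unique∧set⇒bag)
open import Data.List.Relation.Binary.BagAndSetEquality using (∼bag⇒↭)
open import Data.List.Relation.Binary.Permutation.Propositional using (_↭_; ↭-sym; ↭⇒↭ₛ)
import Data.List.Relation.Binary.Permutation.Propositional.Properties as ↭
open ↭ using (↭-length)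
open import Data.List.Relation.Binary.Permutation.Setoid.Properties using (foldr-commMonoid)
import Data.List.Relation.Unary.All as All
open import Data.List.Relation.Unary.All.Properties using (¬Any⇒All¬; All¬⇒¬Any)
open import Data.List.Relation.Unary.AllPairs using (_∷_)
open import Data.List.Relation.Unary.Any using (Any; any?; here; there)
open import Data.List.Relation.Unary.Unique.Propositional using (Unique)
import Data.List.Relation.Unary.Unique.Propositional.Properties as Unique
open import Data.Nat
  using (zero; suc; _+_; _*_; _^_; _∸_; _/_; _≤_; _<?_; _≟_; z≤n; s≤s; s≤s⁻¹; z<s;
         NonZero; ≢-nonZero⁻¹; >-nonZero; >-nonZero⁻¹; ⌊_/2⌋; ⌈_/2⌉)
import Data.Nat.Properties as ℕ
open import Data.Nat.Coprimality using (Coprime; coprime-divisor)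
open import Data.Nat.Divisibility
  using (_∣_; _∤_; _∣?_; divides; ∣-refl; ∣-trans; _∣0; ∣⇒≤; 0∣⇒≡0;
         m∣m*n; n∣m*n; ∣n⇒∣m*n; m*n∣⇒m∣; *-monoˡ-∣; *-cancelˡ-∣; m/n∣m)
open import Data.Nat.DivMod
  using (m/n≡1+[m∸n]/n; m<n*o⇒m/o<n; m*n/n≡m; m*[n/m]≡n; /-monoˡ-≤; /-congˡ)
open import Data.Nat.GCD using (gcd[m,n]∣m; gcd[m,n]∣n; gcd-greatest)
open import Data.Nat.ListAction using (product)
open import Data.Nat.Primality
  using (Prime; prime?; euclidsLemma; prime⇒irreducible; prime⇒nonZero; ¬prime[1])
open import Data.Nat.Primality.Factorisation using (factorise)
open import Data.Product as Product using (_×_; _,_; proj₂; ∃)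
open import Data.Sum as Sum using (_⊎_; inj₁; inj₂)
open import Function using (_∘_; _⇔_; mk⇔; Equivalence)
import Function.Properties.Equivalence as ⇔
open import Relation.Binary.Definitions using (DecidableEquality)
open import Relation.Binary.PropositionalEquality
  using (_≢_; refl; sym; trans; cong; cong₂; subst; setoid; ≢-sym; module ≡-Reasoning)
open import Relation.Nullary using (¬_; Dec; yes; no; does; ¬?; contradiction)
open import Relation.Nullary.Decidable using (_×-dec_; does-⇔; dec-true; dec-false)
open import Relation.Unary using (Pred; Decidable)

private variable
  a b p : Level
  A : Set a
  B : Set b

unique∧set⇒↭ : {xs ys : List A} → Unique xs → Unique ys → (∀ {x} → x ∈ xs ⇔ x ∈ ys) → xs ↭ ys
unique∧set⇒↭ xs! ys! xs≈ys = ∼bag⇒↭ (unique∧set⇒bag xs! ys! xs≈ys)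

∑ : (A → ℤ) → List A → ℤ
∑ f xs = sumℤ (map f xs)

∑-cong : {f g : A → ℤ} (xs : List A) → (∀ {x} → x ∈ xs → f x ≡ g x) → ∑ f xs ≡ ∑ g xs
∑-cong xs f≗g = cong sumℤ (List.map-cong-local (All.tabulate f≗g))

∑-↭ : (f : A → ℤ) {xs ys : List A} → xs ↭ ys → ∑ f xs ≡ ∑ f ys
∑-↭ f xs↭ys = foldr-commMonoid (setoid ℤ) ℤ.+-0-isCommutativeMonoid (↭⇒↭ₛ (↭.map⁺ f xs↭ys))

∑-map : (f : B → ℤ) (g : A → B) (xs : List A) → ∑ f (map g xs) ≡ ∑ (f ∘ g) xs
∑-map f g xs = cong sumℤ (sym (List.map-∘ xs))

∑-0 : (xs : List A) → ∑ (λ _ → 0ℤ) xs ≡ 0ℤ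
∑-0 []       = refl
∑-0 (x ∷ xs) = trans (ℤ.+-identityˡ _) (∑-0 xs)

∑-+ : (f g : A → ℤ) (xs : List A) → ∑ (λ x → f x +ℤ g x) xs ≡ ∑ f xs +ℤ ∑ g xs
∑-+ f g []       = refl
∑-+ f g (x ∷ xs) = trans (cong (f x +ℤ g x +ℤ_) (∑-+ f g xs)) (interchange (f x) (g x) _ _)

∑-*ˡ : (c : ℤ) (f : A → ℤ) (xs : List A) → ∑ (λ x → c *ℤ f x) xs ≡ c *ℤ ∑ f xs
∑-*ˡ c f []       = sym (ℤ.*-zeroʳ c)
∑-*ˡ c f (x ∷ xs) = trans (cong (c *ℤ f x +ℤ_) (∑-*ˡ c f xs)) (sym (ℤ.*-distribˡ-+ c (f x) _))

∑-neg : (f : A → ℤ) (xs : List A) → ∑ (λ x → - f x) xs ≡ - ∑ f xs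
∑-neg f []       = refl
∑-neg f (x ∷ xs) = trans (cong (- f x +ℤ_) (∑-neg f xs)) (sym (ℤ.neg-distrib-+ (f x) _))

∑-swap : (f : A → B → ℤ) (xs : List A) (ys : List B) →
         ∑ (λ x → ∑ (f x) ys) xs ≡ ∑ (λ y → ∑ (λ x → f x y) xs) ys
∑-swap f []       ys = sym (∑-0 ys)
∑-swap f (x ∷ xs) ys = trans (cong (∑ (f x) ys +ℤ_) (∑-swap f xs ys))
                             (sym (∑-+ (f x) (λ y → ∑ (λ x → f x y) xs) ys))

χ : Dec A → ℤ
χ a? = if does a? then 1ℤ else 0ℤ

module _ {P : Pred A p} (P? : Decidable P) where

  length-filter≡∑χ : (xs : List A) → + length (filter P? xs) ≡ ∑ (χ ∘ P?) xs
  length-filter≡∑χ []       = refl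
  length-filter≡∑χ (x ∷ xs) with P? x
  ... | yes _ = cong (1ℤ +ℤ_) (length-filter≡∑χ xs)
  ... | no _  = trans (length-filter≡∑χ xs) (sym (ℤ.+-identityˡ _))

  ∑-filter : (f : A → ℤ) (xs : List A) → ∑ f (filter P? xs) ≡ ∑ (λ x → f x *ℤ χ (P? x)) xs
  ∑-filter f []       = refl
  ∑-filter f (x ∷ xs) with P? x
  ... | yes _ = cong₂ _+ℤ_ (sym (ℤ.*-identityʳ (f x))) (∑-filter f xs)
  ... | no _  = trans (∑-filter f xs)
                      (sym (trans (cong (_+ℤ _) (ℤ.*-zeroʳ (f x))) (ℤ.+-identityˡ _)))

  ∑-partition : (f : A → ℤ) (xs : List A) →
                ∑ f xs ≡ ∑ f (filter P? xs) +ℤ ∑ f (filter (¬? ∘ P?) xs)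
  ∑-partition f []       = refl
  ∑-partition f (x ∷ xs) with P? x
  ... | yes _ = trans (cong (f x +ℤ_) (∑-partition f xs)) (sym (ℤ.+-assoc (f x) _ _))
  ... | no _  = trans (cong (f x +ℤ_) (∑-partition f xs))
                      (x∙yz≈y∙xz (f x) (∑ f (filter P? xs)) _)

  length-filter-map : (f : B → A) (xs : List B) →
                      length (filter P? (map f xs)) ≡ length (filter (P? ∘ f) xs)
  length-filter-map f []       = refl
  length-filter-map f (x ∷ xs) with P? (f x)
  ... | yes _ = cong suc (length-filter-map f xs)
  ... | no _  = length-filter-map f xs

  length-filter-split : ∀ {q} {Q : Pred A q} (Q? : Decidable Q) (xs : List A) →
    length (filter P? xs) ≡ length (filter (λ x → Q? x ×-dec P? x) xs)
                          + length (filter (λ x → ¬? (Q? x) ×-dec P? x) xs)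
  length-filter-split Q? []       = refl
  length-filter-split Q? (x ∷ xs) with Q? x | P? x
  ... | yes _ | yes _ = cong suc (length-filter-split Q? xs)
  ... | no _  | yes _ = trans (cong suc (length-filter-split Q? xs)) (sym (ℕ.+-suc _ _))
  ... | yes _ | no _  = length-filter-split Q? xs
  ... | no _  | no _  = length-filter-split Q? xs

∈-range1⁺ : ∀ {m x} → .{{NonZero x}} → x ≤ m → x ∈ range1 m
∈-range1⁺ {x = suc i} i<m = ∈-map⁺ suc (∈-upTo⁺ i<m)

∈-range1⁻ : ∀ {m x} → x ∈ range1 m → NonZero x × x ≤ m
∈-range1⁻ x∈ with ∈-map⁻ suc x∈
... | _ , i∈ , refl = _ , ∈-upTo⁻ i∈

range1-unique : ∀ m → Unique (range1 m)
range1-unique m = Unique.map⁺ ℕ.suc-injective (Unique.upTo⁺ m)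

∣⇒nonZero : ∀ {m d} → .{{NonZero m}} → d ∣ m → NonZero d
∣⇒nonZero {m} {zero}  0∣m = contradiction (0∣⇒≡0 0∣m) (≢-nonZero⁻¹ m)
∣⇒nonZero {m} {suc _} _   = _

∣⇒∈range1 : ∀ {m d} → .{{NonZero m}} → d ∣ m → d ∈ range1 m
∣⇒∈range1 d∣m = ∈-range1⁺ {{∣⇒nonZero d∣m}} (∣⇒≤ d∣m)

module _ {m : ℕ} .{{_ : NonZero m}} {P : Pred ℕ p} (P? : Decidable P)
         (P⇒∣ : ∀ {x} → P x → x ∣ m) where

  ∈-filter-range1⇔ : ∀ {x} → x ∈ filter P? (range1 m) ⇔ P x
  ∈-filter-range1⇔ = mk⇔ (proj₂ ∘ ∈-filter⁻ P? {xs = range1 m})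
                         (λ px → ∈-filter⁺ P? (∣⇒∈range1 (P⇒∣ px)) px)

  filter-range1-unique : Unique (filter P? (range1 m))
  filter-range1-unique = Unique.filter⁺ P? {xs = range1 m} (range1-unique m)

  any-range1⇔ : Any P (range1 m) ⇔ ∃ P
  any-range1⇔ = mk⇔ (λ any → let x , _ , px = find any in x , px)
                    (λ (x , px) → lose (∣⇒∈range1 (P⇒∣ px)) px)

module _ {n : ℕ} .{{_ : NonZero n}} where

  ∈-divisors⇔ : ∀ {d} → d ∈ divisors n ⇔ d ∣ n
  ∈-divisors⇔ = ∈-filter-range1⇔ (_∣? n) (λ d∣n → d∣n)

  divisors-unique : Unique (divisors n)
  divisors-unique = filter-range1-unique (_∣? n) (λ d∣n → d∣n)

  divisors-nonZero : ∀ {d} → d ∈ divisors n → NonZero d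
  divisors-nonZero d∈ = ∣⇒nonZero (Equivalence.to ∈-divisors⇔ d∈)

filter-∣-divisors↭ : ∀ {n g} .{{_ : NonZero n}} .{{_ : NonZero g}} → g ∣ n →
                     filter (_∣? g) (divisors n) ↭ divisors g
filter-∣-divisors↭ {n} {g} g∣n =
  unique∧set⇒↭ (Unique.filter⁺ (_∣? g) {xs = divisors n} divisors-unique) divisors-unique
    (mk⇔ (Equivalence.from ∈-divisors⇔ ∘ proj₂ ∘ ∈-filter⁻ (_∣? g) {xs = divisors n})
         (λ d∈ → let d∣g = Equivalence.to ∈-divisors⇔ d∈ in
                 ∈-filter⁺ (_∣? g) (Equivalence.from ∈-divisors⇔ (∣-trans d∣g g∣n)) d∣g))

prime∣prime : ∀ {p q} → Prime p → Prime q → p ∣ q → p ≡ q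
prime∣prime pp pq p∣q with prime⇒irreducible pq p∣q
... | inj₁ refl = contradiction pp ¬prime[1]
... | inj₂ p≡q  = p≡q

prime∤⇒coprime : ∀ {p x} → Prime p → p ∤ x → Coprime x p
prime∤⇒coprime pp p∤x (i∣x , i∣p) with prime⇒irreducible pp i∣p
... | inj₁ i≡1  = i≡1
... | inj₂ refl = contradiction i∣x p∤x

prime∣p*e⇒≡⊎∣ : ∀ {p q} e → Prime p → Prime q → q ∣ p * e → q ≡ p ⊎ q ∣ e
prime∣p*e⇒≡⊎∣ {p} e pp pq q∣pe = Sum.map₁ (prime∣prime pq pp) (euclidsLemma p e pq q∣pe)

prime²∣p*e⇒prime²∣e : ∀ {p q e} → Prime p → p ∤ e → Prime q → q * q ∣ p * e → q * q ∣ e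
prime²∣p*e⇒prime²∣e {p} {q} pp p∤e pq qq∣pe with p ∣? q * q
... | no p∤qq  = coprime-divisor (prime∤⇒coprime pp p∤qq) qq∣pe
... | yes p∣qq with refl ← prime∣prime pp pq (Sum.reduce (euclidsLemma q q pp p∣qq)) =
  contradiction (*-cancelˡ-∣ p {{prime⇒nonZero pp}} qq∣pe) p∤e

p∣g∧k∣g⇒p*k∣g : ∀ {p k g} → Prime p → p ∤ k → p ∣ g → k ∣ g → p * k ∣ g
p∣g∧k∣g⇒p*k∣g {p} {k} pp p∤k p∣g (divides j refl) with euclidsLemma j k pp p∣g
... | inj₁ (divides i refl) = divides i (ℕ.*-assoc i p k)
... | inj₂ p∣k              = contradiction p∣k p∤k

∃prime∣ : ∀ {g} → .{{NonZero g}} → g ≢ 1 → ∃ λ p → Prime p × p ∣ g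
∃prime∣ {g} g≢1 with factorise g
... | record { factors = [] ; isFactorisation = g≡1 } = contradiction g≡1 g≢1
... | record { factors = p ∷ ps ; isFactorisation = g≡pps ; factorsPrime = pp All.∷ _ } =
  p , pp , subst (p ∣_) (sym g≡pps) (m∣m*n (product ps))

-- The list counted by ω and the test on which μ branches (see Defs), named so that
-- ω m ≡ length (primeDivisors m) and μ m unfolds to a case on primeSquareDivisor? m.
primeDivisors : ℕ → List ℕ
primeDivisors m = filter (λ q → prime? q ×-dec (q ∣? m)) (range1 m)

primeSquareDivisor? : (m : ℕ) → Dec (Any (λ q → Prime q × q * q ∣ m) (range1 m))
primeSquareDivisor? m = any? (λ q → prime? q ×-dec (q * q ∣? m)) (range1 m)

module _ {m : ℕ} .{{_ : NonZero m}} where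

  ∈-primeDivisors⇔ : ∀ {q} → q ∈ primeDivisors m ⇔ (Prime q × q ∣ m)
  ∈-primeDivisors⇔ = ∈-filter-range1⇔ (λ q → prime? q ×-dec (q ∣? m)) proj₂

  primeDivisors-unique : Unique (primeDivisors m)
  primeDivisors-unique = filter-range1-unique (λ q → prime? q ×-dec (q ∣? m)) proj₂

  primeSquareDivisor⇔ : Any (λ q → Prime q × q * q ∣ m) (range1 m) ⇔ ∃ (λ q → Prime q × q * q ∣ m)
  primeSquareDivisor⇔ =
    any-range1⇔ (λ q → prime? q ×-dec (q * q ∣? m)) (λ (_ , qq∣m) → m*n∣⇒m∣ _ _ qq∣m)

  prime²∣⇒μ≡0 : ∀ {q} → Prime q → q * q ∣ m → μ m ≡ 0ℤ
  prime²∣⇒μ≡0 pq qq∣m = cong (λ b → if b then 0ℤ else -1ℤ ^ℤ ω m)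
    (dec-true (primeSquareDivisor? m) (Equivalence.from primeSquareDivisor⇔ (_ , pq , qq∣m)))

module _ {p e : ℕ} .{{_ : NonZero e}} (pp : Prime p) (p∤e : p ∤ e) where

  private instance
    _ = prime⇒nonZero pp
    _ = ℕ.m*n≢0 p e

  primeDivisors[p*e]↭ : primeDivisors (p * e) ↭ p ∷ primeDivisors e
  primeDivisors[p*e]↭ =
    unique∧set⇒↭ (primeDivisors-unique {p * e}) (p∉ ∷ primeDivisors-unique) (mk⇔ to from)
    where
    p∉ : All.All (p ≢_) (primeDivisors e)
    p∉ = ¬Any⇒All¬ _ (λ p∈ → p∤e (proj₂ (Equivalence.to ∈-primeDivisors⇔ p∈)))
    to : ∀ {q} → q ∈ primeDivisors (p * e) → q ∈ p ∷ primeDivisors e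
    to q∈ with pq , q∣pe ← Equivalence.to (∈-primeDivisors⇔ {p * e}) q∈
          with prime∣p*e⇒≡⊎∣ e pp pq q∣pe
    ... | inj₁ q≡p = here q≡p
    ... | inj₂ q∣e = there (Equivalence.from ∈-primeDivisors⇔ (pq , q∣e))
    from : ∀ {q} → q ∈ p ∷ primeDivisors e → q ∈ primeDivisors (p * e)
    from (here refl) = Equivalence.from (∈-primeDivisors⇔ {p * e}) (pp , m∣m*n e)
    from (there q∈) with pq , q∣e ← Equivalence.to ∈-primeDivisors⇔ q∈ =
      Equivalence.from (∈-primeDivisors⇔ {p * e}) (pq , ∣n⇒∣m*n p q∣e)

  ω[p*e]≡1+ω[e] : ω (p * e) ≡ suc (ω e)
  ω[p*e]≡1+ω[e] = ↭-length primeDivisors[p*e]↭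

  primeSquareDivisor?-p* : does (primeSquareDivisor? (p * e)) ≡ does (primeSquareDivisor? e)
  primeSquareDivisor?-p* =
    does-⇔ (⇔.trans primeSquareDivisor⇔ (⇔.trans square∣pe⇔square∣e (⇔.sym primeSquareDivisor⇔)))
           (primeSquareDivisor? (p * e)) (primeSquareDivisor? e)
    where
    square∣pe⇔square∣e : (∃ λ q → Prime q × q * q ∣ p * e) ⇔ (∃ λ q → Prime q × q * q ∣ e)
    square∣pe⇔square∣e =
      mk⇔ (λ (q , pq , qq∣pe) → q , pq , prime²∣p*e⇒prime²∣e pp p∤e pq qq∣pe)
          (λ (q , pq , qq∣e) → q , pq , ∣n⇒∣m*n p qq∣e)

  μ[p*e]≡-μ[e] : μ (p * e) ≡ - μ e
  μ[p*e]≡-μ[e] = begin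
    μ (p * e)
      ≡⟨ cong₂ (λ b k → if b then 0ℤ else -1ℤ ^ℤ k) primeSquareDivisor?-p* ω[p*e]≡1+ω[e] ⟩
    (if does (primeSquareDivisor? e) then 0ℤ else -1ℤ ^ℤ suc (ω e))
      ≡⟨ negate (does (primeSquareDivisor? e)) ⟩
    - μ e ∎
    where
    open ≡-Reasoning
    negate : ∀ b → (if b then 0ℤ else -1ℤ ^ℤ suc (ω e)) ≡ - (if b then 0ℤ else -1ℤ ^ℤ ω e)
    negate true  = refl
    negate false = ℤ.-1*i≡-i _

-- Among the divisors of g, those divisible by p² have μ = 0, and d ↦ p * d maps the divisors
-- prime to p onto the remaining ones while flipping the sign of μ.
module _ {g p : ℕ} .{{_ : NonZero g}} (pp : Prime p) (p∣g : p ∣ g) where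

  private
    instance _ = prime⇒nonZero pp
    coprimeDivisors multiples squarefull exact : List ℕ
    coprimeDivisors = filter (¬? ∘ (p ∣?_)) (divisors g)
    multiples       = filter (p ∣?_) (divisors g)
    squarefull      = filter (p * p ∣?_) multiples
    exact           = filter (¬? ∘ (p * p ∣?_)) multiples

  exact↭p*coprime : exact ↭ map (p *_) coprimeDivisors
  exact↭p*coprime = unique∧set⇒↭
    (Unique.filter⁺ _ {xs = multiples} (Unique.filter⁺ _ {xs = divisors g} divisors-unique))
    (Unique.map⁺ (ℕ.*-cancelˡ-≡ _ _ p) (Unique.filter⁺ _ {xs = divisors g} divisors-unique))
    (mk⇔ to from)
    where
    to : ∀ {d} → d ∈ exact → d ∈ map (p *_) coprimeDivisors
    to d∈ with d∈ₘ , p²∤d ← ∈-filter⁻ (¬? ∘ (p * p ∣?_)) {xs = multiples} d∈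
         with d∈ₛ , divides k refl ← ∈-filter⁻ (p ∣?_) {xs = divisors g} d∈ₘ
      = subst (_∈ map (p *_) coprimeDivisors) (ℕ.*-comm p k)
          (∈-map⁺ (p *_) (∈-filter⁺ (¬? ∘ (p ∣?_)) k∈ (λ p∣k → p²∤d (*-monoˡ-∣ p p∣k))))
      where
      k∈ : k ∈ divisors g
      k∈ = Equivalence.from ∈-divisors⇔ (∣-trans (m∣m*n p) (Equivalence.to ∈-divisors⇔ d∈ₛ))
    from : ∀ {d} → d ∈ map (p *_) coprimeDivisors → d ∈ exact
    from d∈ with k , k∈ , refl ← ∈-map⁻ (p *_) d∈
            with k∈ₛ , p∤k ← ∈-filter⁻ (¬? ∘ (p ∣?_)) {xs = divisors g} k∈
      = ∈-filter⁺ (¬? ∘ (p * p ∣?_)) (∈-filter⁺ (p ∣?_) pk∈ (m∣m*n k))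
                  (λ p²∣pk → p∤k (*-cancelˡ-∣ p p²∣pk))
      where
      pk∈ : p * k ∈ divisors g
      pk∈ = Equivalence.from ∈-divisors⇔
              (p∣g∧k∣g⇒p*k∣g pp p∤k p∣g (Equivalence.to ∈-divisors⇔ k∈ₛ))

  ∑μ-squarefull : ∑ μ squarefull ≡ 0ℤ
  ∑μ-squarefull = trans (∑-cong squarefull μ≡0) (∑-0 squarefull)
    where
    μ≡0 : ∀ {d} → d ∈ squarefull → μ d ≡ 0ℤ
    μ≡0 d∈ with d∈ₘ , p²∣d ← ∈-filter⁻ (p * p ∣?_) {xs = multiples} d∈
           with d∈ₛ , _ ← ∈-filter⁻ (p ∣?_) {xs = divisors g} d∈ₘ
      = prime²∣⇒μ≡0 {{divisors-nonZero d∈ₛ}} pp p²∣d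

  ∑μ-exact : ∑ μ exact ≡ - ∑ μ coprimeDivisors
  ∑μ-exact = begin
    ∑ μ exact                        ≡⟨ ∑-↭ μ exact↭p*coprime ⟩
    ∑ μ (map (p *_) coprimeDivisors) ≡⟨ ∑-map μ (p *_) coprimeDivisors ⟩
    ∑ (μ ∘ (p *_)) coprimeDivisors   ≡⟨ ∑-cong coprimeDivisors μ[p*e]≡-μ[e]-on ⟩
    ∑ (-_ ∘ μ) coprimeDivisors       ≡⟨ ∑-neg μ coprimeDivisors ⟩
    - ∑ μ coprimeDivisors            ∎
    where
    open ≡-Reasoning
    μ[p*e]≡-μ[e]-on : ∀ {e} → e ∈ coprimeDivisors → μ (p * e) ≡ - μ e
    μ[p*e]≡-μ[e]-on e∈ with e∈ₛ , p∤e ← ∈-filter⁻ (¬? ∘ (p ∣?_)) {xs = divisors g} e∈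
      = μ[p*e]≡-μ[e] {{divisors-nonZero e∈ₛ}} pp p∤e

  ∑μ-divisors≡0 : ∑ μ (divisors g) ≡ 0ℤ
  ∑μ-divisors≡0 = begin
    ∑ μ (divisors g)
      ≡⟨ ∑-partition (p ∣?_) μ (divisors g) ⟩
    ∑ μ multiples +ℤ ∑ μ coprimeDivisors
      ≡⟨ cong (_+ℤ ∑ μ coprimeDivisors) (∑-partition (p * p ∣?_) μ multiples) ⟩
    (∑ μ squarefull +ℤ ∑ μ exact) +ℤ ∑ μ coprimeDivisors
      ≡⟨ cong (λ s → (s +ℤ ∑ μ exact) +ℤ ∑ μ coprimeDivisors) ∑μ-squarefull ⟩
    (0ℤ +ℤ ∑ μ exact) +ℤ ∑ μ coprimeDivisors
      ≡⟨ cong (_+ℤ ∑ μ coprimeDivisors) (trans (ℤ.+-identityˡ _) ∑μ-exact) ⟩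
    - ∑ μ coprimeDivisors +ℤ ∑ μ coprimeDivisors
      ≡⟨ ℤ.+-inverseˡ (∑ μ coprimeDivisors) ⟩
    0ℤ ∎
    where open ≡-Reasoning

∑μ-divisors : ∀ g .{{_ : NonZero g}} → ∑ μ (divisors g) ≡ χ (g ≟ 1)
∑μ-divisors g with g ≟ 1
... | yes refl = refl
... | no g≢1 with p , pp , p∣g ← ∃prime∣ g≢1 =
  trans (∑μ-divisors≡0 pp p∣g) (cong (λ b → if b then 1ℤ else 0ℤ) (sym (dec-false (g ≟ 1) g≢1)))

∣gcdList⇔ : ∀ {d} (A : List ℕ) → d ∣ gcdList A ⇔ All.All (d ∣_) A
∣gcdList⇔ A = mk⇔ (to A) (from A)
  where
  to : ∀ {d} A → d ∣ gcdList A → All.All (d ∣_) A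
  to []      _     = All.[]
  to (x ∷ A) d∣gcd = ∣-trans d∣gcd (gcd[m,n]∣m x _) All.∷ to A (∣-trans d∣gcd (gcd[m,n]∣n x _))
  from : ∀ {d} A → All.All (d ∣_) A → d ∣ gcdList A
  from []      _               = _ ∣0
  from (x ∷ A) (d∣x All.∷ d∣A) = gcd-greatest d∣x (from A d∣A)

∈⇒gcdList∣ : ∀ {n} {A : List ℕ} → n ∈ A → gcdList A ∣ n
∈⇒gcdList∣ {A = A} n∈A = All.lookup (Equivalence.to (∣gcdList⇔ A) ∣-refl) n∈A

module _ {A : Set} {P : Pred A p} (P? : Decidable P) where

  length-filter-all-powerset : (xs : List A) →
                               length (filter (All.all? P?) (powerset xs)) ≡ 2 ^ length (filter P? xs)
  length-filter-all-powerset []       = refl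
  length-filter-all-powerset (x ∷ xs) = begin
    length (filter (All.all? P?) (ps ++ map (x ∷_) ps))
      ≡⟨ cong length (List.filter-++ (All.all? P?) ps _) ⟩
    length (filter (All.all? P?) ps ++ filter (All.all? P?) (map (x ∷_) ps))
      ≡⟨ List.length-++ (filter (All.all? P?) ps) ⟩
    length (filter (All.all? P?) ps) + length (filter (All.all? P?) (map (x ∷_) ps))
      ≡⟨ cong (_+_ (length (filter (All.all? P?) ps))) (length-filter-map (All.all? P?) (x ∷_) ps) ⟩
    length (filter (All.all? P?) ps) + length (filter (All.all? P? ∘ (x ∷_)) ps)
      ≡⟨ extend (P? x) ⟩
    2 ^ length (filter P? (x ∷ xs)) ∎
    where
    open ≡-Reasoning
    ps = powerset xs
    ih = length-filter-all-powerset xs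
    extend : Dec (P x) → length (filter (All.all? P?) ps) + length (filter (All.all? P? ∘ (x ∷_)) ps)
                          ≡ 2 ^ length (filter P? (x ∷ xs))
    extend (yes px) rewrite List.filter-accept P? {xs = xs} px =
      cong₂ _+_ ih (trans (cong length (List.filter-≐ _ (All.all? P?) (All.tail , (px All.∷_)) ps))
                          (trans ih (sym (ℕ.+-identityʳ _))))
    extend (no ¬px) rewrite List.filter-reject P? {xs = xs} ¬px =
      trans (cong₂ _+_ ih (cong length (List.filter-none (All.all? P? ∘ (x ∷_))
                                          (All.universal (λ _ → ¬px ∘ All.head) ps))))
            (ℕ.+-identityʳ _)

module _ {A : Set} (_≟ᴬ_ : DecidableEquality A) {P : Pred A p} (P? : Decidable P) where

  open import Data.List.Membership.DecPropositional _≟ᴬ_ using (_∈?_)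

  P≢? : (x : A) → Decidable (λ y → P y × y ≢ x)
  P≢? x y = P? y ×-dec ¬? (y ≟ᴬ x)

  module _ {x : A} {xs : List A} (xs! : Unique xs) (x∈xs : x ∈ xs) (px : P x) where

    filter↭∷filter≢ : filter P? xs ↭ x ∷ filter (P≢? x) xs
    filter↭∷filter≢ =
      unique∧set⇒↭ (Unique.filter⁺ P? xs!) (x∉ ∷ Unique.filter⁺ (P≢? x) xs!) (mk⇔ to from)
      where
      x∉ : All.All (x ≢_) (filter (P≢? x) xs)
      x∉ = All.tabulate (λ y∈ → ≢-sym (proj₂ (proj₂ (∈-filter⁻ (P≢? x) {xs = xs} y∈))))
      to : ∀ {y} → y ∈ filter P? xs → y ∈ x ∷ filter (P≢? x) xs
      to {y} y∈ with y∈xs , py ← ∈-filter⁻ P? {xs = xs} y∈ with y ≟ᴬ x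
      ... | yes refl = here refl
      ... | no y≢x   = there (∈-filter⁺ (P≢? x) y∈xs (py , y≢x))
      from : ∀ {y} → y ∈ x ∷ filter (P≢? x) xs → y ∈ filter P? xs
      from (here refl) = ∈-filter⁺ P? x∈xs px
      from (there y∈) with y∈xs , py , _ ← ∈-filter⁻ (P≢? x) {xs = xs} y∈ =
        ∈-filter⁺ P? y∈xs py

    length-filter-∋ : length (filter P? xs) ≡ suc (length (filter (P≢? x) xs))
    length-filter-∋ = ↭-length filter↭∷filter≢

  length-filter-∌-all-powerset : (x : A) (xs : List A) →
    length (filter (λ B → ¬? (x ∈? B) ×-dec All.all? P? B) (powerset xs))
      ≡ 2 ^ length (filter (P≢? x) xs)
  length-filter-∌-all-powerset x xs =
    trans (cong length (List.filter-≐ _ (All.all? (P≢? x)) (∌∧all⇒ , ⇒∌∧all) (powerset xs)))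
          (length-filter-all-powerset (P≢? x) xs)
    where
    ∌∧all⇒ : ∀ {B} → ¬ x ∈ B × All.All P B → All.All (λ y → P y × y ≢ x) B
    ∌∧all⇒ {B} (x∉B , allP) = All.zip (allP , All.map ≢-sym (¬Any⇒All¬ B x∉B))
    ⇒∌∧all : ∀ {B} → All.All (λ y → P y × y ≢ x) B → ¬ x ∈ B × All.All P B
    ⇒∌∧all all with allP , all≢ ← All.unzip all = All¬⇒¬Any (All.map ≢-sym all≢) , allP

  length-filter-∋-all-powerset : ∀ {x xs} → Unique xs → x ∈ xs → P x →
    length (filter (λ B → (x ∈? B) ×-dec All.all? P? B) (powerset xs))
      ≡ 2 ^ (length (filter P? xs) ∸ 1)
  length-filter-∋-all-powerset {x} {xs} xs! x∈xs px rewrite length-filter-∋ xs! x∈xs px =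
    ℕ.+-cancelʳ-≡ _ _ (2 ^ k) (begin
      X + 2 ^ k
        ≡⟨ cong (_+_ X) (sym (length-filter-∌-all-powerset x xs)) ⟩
      X + length (filter (λ B → ¬? (x ∈? B) ×-dec All.all? P? B) (powerset xs))
        ≡⟨ sym (length-filter-split (All.all? P?) (x ∈?_) (powerset xs)) ⟩
      length (filter (All.all? P?) (powerset xs))
        ≡⟨ length-filter-all-powerset P? xs ⟩
      2 ^ length (filter P? xs)
        ≡⟨ cong (2 ^_) (length-filter-∋ xs! x∈xs px) ⟩
      2 ^ k + (2 ^ k + 0)
        ≡⟨ cong (_+_ (2 ^ k)) (ℕ.+-identityʳ (2 ^ k)) ⟩
      2 ^ k + 2 ^ k ∎)
    where
    open ≡-Reasoning
    k = length (filter (P≢? x) xs)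
    X = length (filter (λ B → (x ∈? B) ×-dec All.all? P? B) (powerset xs))

n/2≡⌊n/2⌋ : ∀ n → n / 2 ≡ ⌊ n /2⌋
n/2≡⌊n/2⌋ 0             = refl
n/2≡⌊n/2⌋ 1             = refl
n/2≡⌊n/2⌋ (suc (suc n)) =
  trans (m/n≡1+[m∸n]/n {suc (suc n)} {2} (s≤s (s≤s z≤n))) (cong suc (n/2≡⌊n/2⌋ n))

⌈n/2⌉∸1≡[n∸1]/2 : ∀ n → ⌈ n /2⌉ ∸ 1 ≡ (n ∸ 1) / 2
⌈n/2⌉∸1≡[n∸1]/2 zero    = refl
⌈n/2⌉∸1≡[n∸1]/2 (suc n) = sym (n/2≡⌊n/2⌋ n)

<2*⇔/2< : ∀ {m a} → m < 2 * a ⇔ m / 2 < a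
<2*⇔/2< {m} {a} = mk⇔ (λ m<2a → m<n*o⇒m/o<n (subst (m <_) (ℕ.*-comm 2 a) m<2a)) from
  where
  from : m / 2 < a → m < 2 * a
  from m/2<a with m ℕ.<? 2 * a
  ... | yes m<2a = m<2a
  ... | no m≮2a  = contradiction (/-monoˡ-≤ 2 (subst (_≤ m) (ℕ.*-comm 2 a) (ℕ.≮⇒≥ m≮2a)))
                     (λ a*2/2≤m/2 → ℕ.<⇒≱ m/2<a (subst (_≤ m / 2) (m*n/n≡m a 2) a*2/2≤m/2))

range1-∷ʳ : ∀ m → range1 (suc m) ≡ range1 m ++ suc m ∷ []
range1-∷ʳ m = trans (cong (map suc) (sym (List.upTo-∷ʳ m))) (List.map-++ suc (upTo m) (m ∷ []))

length-filter-<-range1 : ∀ t m → length (filter (t <?_) (range1 m)) ≡ m ∸ t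
length-filter-<-range1 t zero    = sym (ℕ.0∸n≡0 t)
length-filter-<-range1 t (suc m) = begin
  length (filter (t <?_) (range1 (suc m)))
    ≡⟨ cong (length ∘ filter (t <?_)) (range1-∷ʳ m) ⟩
  length (filter (t <?_) (range1 m ++ suc m ∷ []))
    ≡⟨ cong length (List.filter-++ (t <?_) (range1 m) _) ⟩
  length (filter (t <?_) (range1 m) ++ filter (t <?_) (suc m ∷ []))
    ≡⟨ List.length-++ (filter (t <?_) (range1 m)) ⟩
  length (filter (t <?_) (range1 m)) + length (filter (t <?_) (suc m ∷ []))
    ≡⟨ cong (_+ length (filter (t <?_) (suc m ∷ []))) (length-filter-<-range1 t m) ⟩
  m ∸ t + length (filter (t <?_) (suc m ∷ []))
    ≡⟨ last (t ℕ.≤? m) ⟩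
  suc m ∸ t ∎
  where
  open ≡-Reasoning
  last : Dec (t ≤ m) → m ∸ t + length (filter (t <?_) (suc m ∷ [])) ≡ suc m ∸ t
  last (yes t≤m) rewrite List.filter-accept (t <?_) {xs = []} (s≤s t≤m) =
    trans (ℕ.+-comm (m ∸ t) 1) (sym (ℕ.+-∸-assoc 1 t≤m))
  last (no t≰m) rewrite List.filter-reject (t <?_) {xs = []} (t≰m ∘ s≤s⁻¹) =
    trans (ℕ.+-identityʳ _) (trans (ℕ.m≤n⇒m∸n≡0 (ℕ.<⇒≤ m<t)) (sym (ℕ.m≤n⇒m∸n≡0 m<t)))
    where m<t = ℕ.≰⇒> t≰m

length-halfInterval : ∀ m → length (halfInterval m) ≡ ⌈ m /2⌉
length-halfInterval m = begin
  length (filter (λ a → m <? 2 * a) (range1 m))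
    ≡⟨ cong length (List.filter-≐ _ (m / 2 <?_) (Equivalence.to <2*⇔/2< , Equivalence.from <2*⇔/2<)
                                  (range1 m)) ⟩
  length (filter (m / 2 <?_) (range1 m))
    ≡⟨ length-filter-<-range1 (m / 2) m ⟩
  m ∸ m / 2
    ≡⟨ cong₂ _∸_ (sym (ℕ.⌊n/2⌋+⌈n/2⌉≡n m)) (n/2≡⌊n/2⌋ m) ⟩
  ⌊ m /2⌋ + ⌈ m /2⌉ ∸ ⌊ m /2⌋
    ≡⟨ ℕ.m+n∸m≡n ⌊ m /2⌋ ⌈ m /2⌉ ⟩
  ⌈ m /2⌉ ∎
  where open ≡-Reasoning

∈-halfInterval⇔ : ∀ {n a} → a ∈ halfInterval n ⇔ (a ≤ n × n < 2 * a)
∈-halfInterval⇔ {n} {a} = mk⇔ to from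
  where
  to : a ∈ halfInterval n → a ≤ n × n < 2 * a
  to a∈ with a∈ᵣ , n<2a ← ∈-filter⁻ (λ a → n <? 2 * a) {xs = range1 n} a∈ =
    proj₂ (∈-range1⁻ a∈ᵣ) , n<2a
  from : a ≤ n × n < 2 * a → a ∈ halfInterval n
  from (a≤n , n<2a) = ∈-filter⁺ (λ a → n <? 2 * a) (∈-range1⁺ {{a≢0}} a≤n) n<2a
    where
    a≢0 : NonZero a
    a≢0 = ℕ.m*n≢0⇒n≢0 2 {{>-nonZero (ℕ.m<n⇒0<n n<2a)}}

halfInterval-unique : ∀ n → Unique (halfInterval n)
halfInterval-unique n = Unique.filter⁺ (λ a → n <? 2 * a) {xs = range1 n} (range1-unique n)

n∈halfInterval : ∀ n → .{{NonZero n}} → n ∈ halfInterval n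
n∈halfInterval n = Equivalence.from ∈-halfInterval⇔
  (ℕ.≤-refl , subst (n <_) (cong (_+_ n) (sym (ℕ.+-identityʳ n))) (ℕ.m<m+n n (>-nonZero⁻¹ n)))

module _ {d : ℕ} .{{_ : NonZero d}} where

  filter-∣-halfInterval↭ : ∀ m → filter (d ∣?_) (halfInterval (m * d)) ↭ map (_* d) (halfInterval m)
  filter-∣-halfInterval↭ m = unique∧set⇒↭
    (Unique.filter⁺ (d ∣?_) {xs = halfInterval (m * d)} (halfInterval-unique (m * d)))
    (Unique.map⁺ (ℕ.*-cancelʳ-≡ _ _ d) (halfInterval-unique m))
    (mk⇔ to from)
    where
    to : ∀ {a} → a ∈ filter (d ∣?_) (halfInterval (m * d)) → a ∈ map (_* d) (halfInterval m)
    to a∈ with a∈ₕ , divides k refl ← ∈-filter⁻ (d ∣?_) {xs = halfInterval (m * d)} a∈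
          with kd≤md , md<2kd ← Equivalence.to ∈-halfInterval⇔ a∈ₕ
      = ∈-map⁺ (_* d) (Equivalence.from (∈-halfInterval⇔ {m})
          (ℕ.*-cancelʳ-≤ k m d kd≤md ,
           ℕ.*-cancelʳ-< d m (2 * k) (subst (m * d <_) (sym (ℕ.*-assoc 2 k d)) md<2kd)))
    from : ∀ {a} → a ∈ map (_* d) (halfInterval m) → a ∈ filter (d ∣?_) (halfInterval (m * d))
    from a∈ with k , k∈ , refl ← ∈-map⁻ (_* d) a∈
            with k≤m , m<2k ← Equivalence.to (∈-halfInterval⇔ {m}) k∈
      = ∈-filter⁺ (d ∣?_)
          (Equivalence.from (∈-halfInterval⇔ {m * d})
            (ℕ.*-monoˡ-≤ d k≤m , subst (m * d <_) (ℕ.*-assoc 2 k d) (ℕ.*-monoˡ-< d m<2k)))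
          (n∣m*n k)

open import Data.List.Membership.DecPropositional _≟_ using (_∈?_)

length-filter-∣gcdList-powerset : ∀ {n d} .{{_ : NonZero n}} .{{_ : NonZero d}} → d ∣ n →
  length (filter (λ A → (n ∈? A) ×-dec (d ∣? gcdList A)) (powerset (halfInterval n)))
    ≡ 2 ^ ((n / d ∸ 1) / 2)
length-filter-∣gcdList-powerset {d = d} (divides m refl) = begin
  length (filter (λ A → (n ∈? A) ×-dec (d ∣? gcdList A)) (powerset (halfInterval n)))
    ≡⟨ cong length (List.filter-≐ _ (λ A → (n ∈? A) ×-dec All.all? (d ∣?_) A)
                     ((λ {A} → Product.map₂ (Equivalence.to (∣gcdList⇔ A))) ,
                      (λ {A} → Product.map₂ (Equivalence.from (∣gcdList⇔ A))))
                     (powerset (halfInterval n))) ⟩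
  length (filter (λ A → (n ∈? A) ×-dec All.all? (d ∣?_) A) (powerset (halfInterval n)))
    ≡⟨ length-filter-∋-all-powerset _≟_ (d ∣?_) (halfInterval-unique n) (n∈halfInterval n)
                                    (n∣m*n m) ⟩
  2 ^ (length (filter (d ∣?_) (halfInterval n)) ∸ 1)
    ≡⟨ cong (λ k → 2 ^ (k ∸ 1)) (↭-length (filter-∣-halfInterval↭ m)) ⟩
  2 ^ (length (map (_* d) (halfInterval m)) ∸ 1)
    ≡⟨ cong (λ k → 2 ^ (k ∸ 1))
            (trans (List.length-map (_* d) (halfInterval m)) (length-halfInterval m)) ⟩
  2 ^ (⌈ m /2⌉ ∸ 1)
    ≡⟨ cong (2 ^_) (⌈n/2⌉∸1≡[n∸1]/2 m) ⟩
  2 ^ ((m ∸ 1) / 2)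
    ≡⟨ cong (λ k → 2 ^ ((k ∸ 1) / 2)) (sym (m*n/n≡m m d)) ⟩
  2 ^ ((n / d ∸ 1) / 2) ∎
  where
  open ≡-Reasoning
  n = m * d

module _ {n : ℕ} .{{_ : NonZero n}} where

  χ[gcd≡1]≡∑μ : ∀ {A} → n ∈ A →
                χ (gcdList A ≟ 1) ≡ ∑ (λ d → μ d *ℤ χ (d ∣? gcdList A)) (divisors n)
  χ[gcd≡1]≡∑μ {A} n∈A = begin
    χ (g ≟ 1)                                 ≡⟨ sym (∑μ-divisors g) ⟩
    ∑ μ (divisors g)                          ≡⟨ ∑-↭ μ (↭-sym (filter-∣-divisors↭ g∣n)) ⟩
    ∑ μ (filter (_∣? g) (divisors n))         ≡⟨ ∑-filter (_∣? g) μ (divisors n) ⟩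
    ∑ (λ d → μ d *ℤ χ (d ∣? g)) (divisors n) ∎
    where
    open ≡-Reasoning
    g = gcdList A
    g∣n = ∈⇒gcdList∣ n∈A
    instance _ = ∣⇒nonZero g∣n

  χ[∈∧gcd≡1]≡∑μ : ∀ A → χ ((n ∈? A) ×-dec (gcdList A ≟ 1))
                      ≡ ∑ (λ d → μ d *ℤ χ ((n ∈? A) ×-dec (d ∣? gcdList A))) (divisors n)
  χ[∈∧gcd≡1]≡∑μ A with n ∈? A
  ... | yes n∈A = χ[gcd≡1]≡∑μ n∈A
  ... | no _    = sym (trans (∑-cong (divisors n) (λ {d} _ → ℤ.*-zeroʳ (μ d))) (∑-0 (divisors n)))

-- n / d as a total function of d, since _/_ demands a NonZero divisor; the value at d = 0 is junk.
codivisor : ℕ → ℕ → ℕ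
codivisor n zero      = 0
codivisor n d@(suc _) = n / d

codivisor≡/ : ∀ n d .{{_ : NonZero d}} → codivisor n d ≡ n / d
codivisor≡/ n (suc _) = refl

module _ {n : ℕ} .{{_ : NonZero n}} where

  module _ {d : ℕ} (d∈ : d ∈ divisors n) where

    private
      d∣n = Equivalence.to ∈-divisors⇔ d∈
      instance
        _ = divisors-nonZero d∈
        _ = ∣⇒nonZero (m/n∣m d∣n)

    codivisor-∈ : codivisor n d ∈ divisors n
    codivisor-∈ = subst (_∈ divisors n) (sym (codivisor≡/ n d))
                        (Equivalence.from ∈-divisors⇔ (m/n∣m d∣n))

    codivisor-involutive : codivisor n (codivisor n d) ≡ d
    codivisor-involutive = begin
      codivisor n (codivisor n d) ≡⟨ cong (codivisor n) (codivisor≡/ n d) ⟩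
      codivisor n (n / d)         ≡⟨ codivisor≡/ n (n / d) ⟩
      n / (n / d)                 ≡⟨ /-congˡ {o = n / d} (sym (m*[n/m]≡n d∣n)) ⟩
      d * (n / d) / (n / d)       ≡⟨ m*n/n≡m d (n / d) ⟩
      d                           ∎
      where open ≡-Reasoning

  map-codivisor↭ : map (codivisor n) (divisors n) ↭ divisors n
  map-codivisor↭ =
    unique∧set⇒↭ (Unique.map⁻ (subst Unique (sym map²≡id) divisors-unique)) divisors-unique
                 (mk⇔ to from)
    where
    map²≡id : map (codivisor n) (map (codivisor n) (divisors n)) ≡ divisors n
    map²≡id = trans (sym (List.map-∘ (divisors n)))
                    (List.map-id-local (All.tabulate codivisor-involutive))
    to : ∀ {e} → e ∈ map (codivisor n) (divisors n) → e ∈ divisors n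
    to e∈ with _ , d∈ , refl ← ∈-map⁻ (codivisor n) e∈ = codivisor-∈ d∈
    from : ∀ {e} → e ∈ divisors n → e ∈ map (codivisor n) (divisors n)
    from e∈ = subst (_∈ map (codivisor n) (divisors n)) (codivisor-involutive e∈)
                    (∈-map⁺ (codivisor n) (codivisor-∈ e∈))

  ∑-codivisor : (f : ℕ → ℤ) → ∑ (f ∘ codivisor n) (divisors n) ≡ ∑ f (divisors n)
  ∑-codivisor f = trans (sym (∑-map f (codivisor n) (divisors n))) (∑-↭ f map-codivisor↭)

  ∑-codivisor-flip : (f : ℕ → ℕ → ℤ) →
    ∑ (λ d → f d (codivisor n d)) (divisors n) ≡ ∑ (λ d → f (codivisor n d) d) (divisors n)
  ∑-codivisor-flip f =
    trans (∑-cong (divisors n) (λ {d} d∈ → cong (λ e → f e (codivisor n d))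
                                                (sym (codivisor-involutive d∈))))
          (∑-codivisor (λ d → f (codivisor n d) d))

-- 2 ^ ⌊(m - 1)/2⌋ is the number of subsets of (m/2, m] that contain m.
subsetsThroughTop : ℕ → ℤ
subsetsThroughTop m = + (2 ^ ((m ∸ 1) / 2))

module _ {n : ℕ} .{{_ : NonZero n}} where

  length-goodSubsets :
    + length (goodSubsets n) ≡ ∑ (λ d → μ d *ℤ subsetsThroughTop (codivisor n d)) (divisors n)
  length-goodSubsets = begin
    + length (goodSubsets n)
      ≡⟨ length-filter≡∑χ (λ A → (n ∈? A) ×-dec (gcdList A ≟ 1)) PS ⟩
    ∑ (λ A → χ ((n ∈? A) ×-dec (gcdList A ≟ 1))) PS
      ≡⟨ ∑-cong PS (λ {A} _ → χ[∈∧gcd≡1]≡∑μ A) ⟩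
    ∑ (λ A → ∑ (λ d → μ d *ℤ χ (Q? d A)) Ds) PS
      ≡⟨ ∑-swap (λ A d → μ d *ℤ χ (Q? d A)) PS Ds ⟩
    ∑ (λ d → ∑ (λ A → μ d *ℤ χ (Q? d A)) PS) Ds
      ≡⟨ ∑-cong Ds count ⟩
    ∑ (λ d → μ d *ℤ subsetsThroughTop (codivisor n d)) Ds ∎
    where
    open ≡-Reasoning
    PS = powerset (halfInterval n)
    Ds = divisors n
    Q? : (d : ℕ) → Decidable (λ A → n ∈ A × d ∣ gcdList A)
    Q? d A = (n ∈? A) ×-dec (d ∣? gcdList A)
    count : ∀ {d} → d ∈ Ds →
            ∑ (λ A → μ d *ℤ χ (Q? d A)) PS ≡ μ d *ℤ subsetsThroughTop (codivisor n d)
    count {d} d∈ = begin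
      ∑ (λ A → μ d *ℤ χ (Q? d A)) PS
        ≡⟨ ∑-*ˡ (μ d) (χ ∘ Q? d) PS ⟩
      μ d *ℤ ∑ (χ ∘ Q? d) PS
        ≡⟨ cong (μ d *ℤ_) (sym (length-filter≡∑χ (Q? d) PS)) ⟩
      μ d *ℤ + length (filter (Q? d) PS)
        ≡⟨ cong (λ k → μ d *ℤ + k) (length-filter-∣gcdList-powerset d∣n) ⟩
      μ d *ℤ subsetsThroughTop (n / d)
        ≡⟨ cong (λ e → μ d *ℤ subsetsThroughTop e) (sym (codivisor≡/ n d)) ⟩
      μ d *ℤ subsetsThroughTop (codivisor n d) ∎
      where
      d∣n = Equivalence.to ∈-divisors⇔ d∈
      instance _ = divisors-nonZero d∈

  rhs≡∑μ∘codivisor : n ≢ 1 →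
                     rhs n ≡ ∑ (λ d → μ (codivisor n d) *ℤ subsetsThroughTop d) (divisors n)
  rhs≡∑μ∘codivisor n≢1 = begin
    rhs n
      ≡⟨ ∑-cong Ds (λ { {zero} 0∈ → contradiction refl (≢-nonZero⁻¹ 0 {{divisors-nonZero 0∈}})
                      ; {d@(suc _)} _ → *-[x-1] (μ (n / d)) (subsetsThroughTop d) }) ⟩
    ∑ (λ d → f d +ℤ - μ (codivisor n d)) Ds
      ≡⟨ ∑-+ f (λ d → - μ (codivisor n d)) Ds ⟩
    ∑ f Ds +ℤ ∑ (λ d → - μ (codivisor n d)) Ds
      ≡⟨ cong (∑ f Ds +ℤ_) (∑-neg (μ ∘ codivisor n) Ds) ⟩
    ∑ f Ds +ℤ - ∑ (μ ∘ codivisor n) Ds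
      ≡⟨ cong (λ s → ∑ f Ds +ℤ - s) ∑μ∘codivisor≡0 ⟩
    ∑ f Ds +ℤ 0ℤ
      ≡⟨ ℤ.+-identityʳ _ ⟩
    ∑ f Ds ∎
    where
    open ≡-Reasoning
    Ds = divisors n
    f : ℕ → ℤ
    f d = μ (codivisor n d) *ℤ subsetsThroughTop d
    *-[x-1] : ∀ a x → a *ℤ (x +ℤ -1ℤ) ≡ a *ℤ x +ℤ - a
    *-[x-1] a x = trans (ℤ.*-distribˡ-+ a x -1ℤ)
                        (cong (a *ℤ x +ℤ_) (trans (ℤ.*-comm a -1ℤ) (ℤ.-1*i≡-i a)))
    ∑μ∘codivisor≡0 : ∑ (μ ∘ codivisor n) Ds ≡ 0ℤ
    ∑μ∘codivisor≡0 = trans (∑-codivisor μ)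
      (trans (∑μ-divisors n) (cong (λ b → if b then 1ℤ else 0ℤ) (dec-false (n ≟ 1) n≢1)))

proposition5p1 : (n : ℕ) → 2 < n → + (length (goodSubsets n)) ≡ rhs n
proposition5p1 n 2<n = begin
  + length (goodSubsets n)
    ≡⟨ length-goodSubsets {n} ⟩
  ∑ (λ d → μ d *ℤ subsetsThroughTop (codivisor n d)) (divisors n)
    ≡⟨ ∑-codivisor-flip {n} (λ d e → μ d *ℤ subsetsThroughTop e) ⟩
  ∑ (λ d → μ (codivisor n d) *ℤ subsetsThroughTop d) (divisors n)
    ≡⟨ sym (rhs≡∑μ∘codivisor (≢-sym (ℕ.<⇒≢ 1<n))) ⟩
  rhs n ∎
  where
  open ≡-Reasoning
  1<n : 1 < n
  1<n = ℕ.<-trans ℕ.≤-refl 2<n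
  instance _ = >-nonZero (ℕ.<-trans z<s 1<n)
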